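{- Let $n\ge 1$ and let $z=(z_1,\ldots,z_{n-1})\in\mathbb{Z}^{n-1}$. Define $S_z=\{0\}\cup\{\sum_{k=1}^{i} z_k : 1\le i\le n-1\}$. Then $z=D(\pi)$ for some permutation $\pi$ of $\{1,2,\ldots,n\}$ if and only if $S_z$ is a set of $n$ consecutive integers containing $0$.
   Context: For a permutation $\pi=(\pi_1,\ldots,\pi_n)$ of $\{1,\ldots,n\}$, its discrete derivative is $D(\pi)=(\pi_2-\pi_1,\ldots,\pi_n-\pi_{n-1})$. -}

module Defs where

open import Data.Nat using (ℕ; suc)
open import Data.Fin using (Fin; toℕ; zero; suc; inject₁; fromℕ)
open import Data.Fin.Permutation using (Permutation′; _⟨$⟩ʳ_)
open import Data.Integer using (ℤ; +_; _+_; _-_; _≤_; 0ℤ)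
open import Data.Product using (Σ; ∃; _×_)
open import Data.Sum using (_⊎_)
open import Relation.Binary.PropositionalEquality using (_≡_)

-- A permutation π of {1,…,n} is a bijection of Fin n; its i-th entry
-- (i = 1..n, represented by Fin n) is the integer toℕ (π i) + 1.
entry : ∀ {n} → Permutation′ n → Fin n → ℤ
entry π i = + suc (toℕ (π ⟨$⟩ʳ i))

D : ∀ {m} → Permutation′ (suc m) → Fin m → ℤ
D π k = entry π (suc k) - entry π (inject₁ k)

psum : ∀ {m} → (Fin m → ℤ) → ℕ → ℤ
psum {ℕ.zero} z i = 0ℤ
psum {suc m} z ℕ.zero = 0ℤ
psum {suc m} z (suc i) = z zero + psum (λ k → z (suc k)) i

S : ∀ {m} → (Fin m → ℤ) → ℤ → Set
S {m} z x = (x ≡ 0ℤ) ⊎ ∃ λ (k : Fin m) → x ≡ psum z (suc (toℕ k))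

ConsecutiveSet : (ℤ → Set) → ℕ → Set
ConsecutiveSet S N = ∃ λ (a : ℤ) →
  ∀ x → (S x → (a ≤ x × x + + 1 ≤ a + + N)) × ((a ≤ x × x + + 1 ≤ a + + N) → S x)

-- Write Pᵢ = z₁ + … + zᵢ for 0 ≤ i < n, so that S_z is the image of P. By telescoping,
-- z = D(π) exactly when Pᵢ = πᵢ₊₁ − π₁ for all i, i.e. when P is a permutation of
-- {0, …, n−1} followed by a shift j ↦ a + j. For maps on a finite set, having the same image
-- as an injective map is the same as differing from it by a permutation; the image of the
-- shift is {a, …, a+n−1}, and 0 = P₀ always lies in S_z.
module Submission where

open import Defs
open import Data.Nat using (ℕ; suc)
open import Data.Fin using (Fin)
open import Data.Fin.Permutation using (Permutation′)
open import Data.Integer using (ℤ; 0ℤ)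
open import Data.Product using (∃; _×_)
open import Function.Bundles using (_⇔_)
open import Relation.Binary.PropositionalEquality using (_≡_)

import Data.Nat as ℕ
import Data.Nat.Properties as ℕ
open import Data.Fin using (zero; suc; toℕ; inject₁; fromℕ<; punchOut)
open import Data.Fin.Properties
  using (any?; _≟_; toℕ<n; toℕ-fromℕ<; toℕ-injective; punchOut-injective; injective⇒≤)
open import Data.Fin.Permutation using (permutation; _⟨$⟩ʳ_; _⟨$⟩ˡ_; inverseʳ)
open import Data.Integer using (+_; -[1+_]; _+_; _-_; -_; _≤_; +≤+)
import Data.Integer.Properties as ℤ
open import Algebra.Properties.AbelianGroup ℤ.+-0-abelianGroup using (∙-cancelˡ)
open import Data.Integer.Tactic.RingSolver using (solve-∀)
open import Data.Product using (_,_; proj₁; proj₂)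
open import Data.Sum using (inj₁; inj₂)
open import Function.Base using (_∘_)
open import Function.Bundles using (mk⇔; module Equivalence)
open import Function.Definitions using (Injective; StrictlyInverseˡ; StrictlyInverseʳ)
open import Relation.Nullary using (yes; no; contradiction)
open import Relation.Binary.PropositionalEquality
  using (_≢_; refl; sym; trans; cong; cong₂; subst; subst₂; module ≡-Reasoning)
open ≡-Reasoning

Image : ∀ {a} {A : Set a} {n} → (Fin n → A) → A → Set a
Image f x = ∃ λ i → f i ≡ x

-- If g missed x, then punchOut x ∘ g would inject Fin n into Fin (n ∸ 1).
strictlyInverseˡ⇒strictlyInverseʳ : ∀ {n} (f g : Fin n → Fin n) →
  StrictlyInverseˡ _≡_ f g → StrictlyInverseʳ _≡_ f g
strictlyInverseˡ⇒strictlyInverseʳ {suc n} f g fg x with any? (λ y → g y ≟ x)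
... | yes (y , gy≡x) = begin
  g (f x)     ≡⟨ cong (g ∘ f) (sym gy≡x) ⟩
  g (f (g y)) ≡⟨ cong g (fg y) ⟩
  g y         ≡⟨ gy≡x ⟩
  x           ∎
... | no ∄y = contradiction (injective⇒≤ {f = g′} g′-injective) ℕ.1+n≰n
  where
  x≢g : ∀ y → x ≢ g y
  x≢g y x≡gy = ∄y (y , sym x≡gy)
  g′ : Fin (suc n) → Fin n
  g′ y = punchOut (x≢g y)
  g′-injective : Injective _≡_ _≡_ g′
  g′-injective {y} {y′} eq = begin
    y           ≡⟨ sym (fg y) ⟩
    f (g y)     ≡⟨ cong f (punchOut-injective (x≢g y) (x≢g y′) eq) ⟩
    f (g y′)    ≡⟨ fg y′ ⟩
    y′          ∎

module _ {a} {A : Set a} {n} (f h : Fin n → A) where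

  SameImage : Set a
  SameImage = ∀ x → (Image f x → Image h x) × (Image h x → Image f x)

  permutation⇒sameImage : (π : Permutation′ n) → (∀ i → f i ≡ h (π ⟨$⟩ʳ i)) → SameImage
  permutation⇒sameImage π f≡h∘π x =
    (λ (i , fi≡x) → π ⟨$⟩ʳ i , trans (sym (f≡h∘π i)) fi≡x) ,
    (λ (j , hj≡x) → π ⟨$⟩ˡ j , trans (f≡h∘π (π ⟨$⟩ˡ j)) (trans (cong h (inverseʳ π)) hj≡x))

  sameImage⇒permutation : Injective _≡_ _≡_ h → SameImage →
    ∃ λ (π : Permutation′ n) → ∀ i → f i ≡ h (π ⟨$⟩ʳ i)
  sameImage⇒permutation h-injective sameImage =
    permutation σ τ στ≡id (strictlyInverseˡ⇒strictlyInverseʳ σ τ στ≡id) , sym ∘ hσ≡f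
    where
    σ : Fin n → Fin n
    σ i = proj₁ (proj₁ (sameImage (f i)) (i , refl))
    hσ≡f : ∀ i → h (σ i) ≡ f i
    hσ≡f i = proj₂ (proj₁ (sameImage (f i)) (i , refl))
    τ : Fin n → Fin n
    τ j = proj₁ (proj₂ (sameImage (h j)) (j , refl))
    fτ≡h : ∀ j → f (τ j) ≡ h j
    fτ≡h j = proj₂ (proj₂ (sameImage (h j)) (j , refl))
    στ≡id : StrictlyInverseˡ _≡_ σ τ
    στ≡id j = h-injective (trans (hσ≡f (τ j)) (fτ≡h j))

Interval : ℤ → ℕ → ℤ → Set
Interval a N x = a ≤ x × x + + 1 ≤ a + + N

shift : ∀ {N} → ℤ → Fin N → ℤ
shift a j = a + + toℕ j

shift-injective : ∀ {N} a → Injective _≡_ _≡_ (shift {N} a)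
shift-injective a = toℕ-injective ∘ ℤ.+-injective ∘ ∙-cancelˡ a _ _

image-shift⇒interval : ∀ {N} a x → Image (shift {N} a) x → Interval a N x
image-shift⇒interval {N} a _ (j , refl) =
  ℤ.i≤i+j a (+ toℕ j) ,
  subst (_≤ a + + N) (sym (ℤ.+-assoc a (+ toℕ j) (+ 1)))
    (ℤ.+-monoʳ-≤ a (+≤+ (subst (ℕ._≤ N) (ℕ.+-comm 1 (toℕ j)) (toℕ<n j))))

interval⇒image-shift : ∀ {N} a x → Interval a N x → Image (shift {N} a) x
interval⇒image-shift {N} a x (a≤x , x<a+N) with x - a in x-a≡d | ℤ.i≤j⇒0≤j-i a≤x
... | -[1+ _ ] | ()
... | + d      | _ = fromℕ< d<N , (begin
  a + + toℕ (fromℕ< d<N) ≡⟨ cong (λ t → a + + t) (toℕ-fromℕ< d<N) ⟩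
  a + + d                ≡⟨ cong (λ t → a + t) x-a≡d ⟨
  a + (x - a)            ≡⟨ a+[x-a]≡x a x ⟩
  x                      ∎)
  where
  a+[x-a]≡x : ∀ a x → a + (x - a) ≡ x
  a+[x-a]≡x = solve-∀
  [x+1]-a≡[x-a]+1 : ∀ x a → (x + + 1) - a ≡ (x - a) + + 1
  [x+1]-a≡[x-a]+1 = solve-∀
  [a+N]-a≡N : ∀ a N → (a + N) - a ≡ N
  [a+N]-a≡N = solve-∀
  d+1≤N : + d + + 1 ≤ + N
  d+1≤N = subst₂ _≤_
    (trans ([x+1]-a≡[x-a]+1 x a) (cong (_+ + 1) x-a≡d)) ([a+N]-a≡N a (+ N))
    (ℤ.+-monoˡ-≤ (- a) x<a+N)
  d<N : d ℕ.< N
  d<N = subst (ℕ._≤ N) (ℕ.+-comm d 1) (ℤ.drop‿+≤+ d+1≤N)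

partialSum : ∀ {m} → (Fin m → ℤ) → Fin (suc m) → ℤ
partialSum z i = psum z (toℕ i)

partialSum-zero : ∀ {m} (z : Fin m → ℤ) → partialSum z zero ≡ 0ℤ
partialSum-zero {ℕ.zero} z = refl
partialSum-zero {suc m}  z = refl

partialSum-suc : ∀ {m} (z : Fin m → ℤ) k →
  partialSum z (suc k) ≡ partialSum z (inject₁ k) + z k
partialSum-suc {suc m} z zero = begin
  z zero + partialSum (z ∘ suc) zero ≡⟨ cong (λ t → z zero + t) (partialSum-zero (z ∘ suc)) ⟩
  z zero + 0ℤ                        ≡⟨ ℤ.+-comm (z zero) 0ℤ ⟩
  0ℤ + z zero                        ∎
partialSum-suc {suc m} z (suc k) = begin
  z zero + partialSum (z ∘ suc) (suc k)
    ≡⟨ cong (λ t → z zero + t) (partialSum-suc (z ∘ suc) k) ⟩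
  z zero + (partialSum (z ∘ suc) (inject₁ k) + z (suc k))
    ≡⟨ ℤ.+-assoc (z zero) _ (z (suc k)) ⟨
  z zero + partialSum (z ∘ suc) (inject₁ k) + z (suc k)
    ∎

image-partialSum⇔S : ∀ {m} (z : Fin m → ℤ) x → Image (partialSum z) x ⇔ S z x
image-partialSum⇔S z x = mk⇔ to from
  where
  to : Image (partialSum z) x → S z x
  to (zero  , refl) = inj₁ (partialSum-zero z)
  to (suc k , refl) = inj₂ (k , refl)
  from : S z x → Image (partialSum z) x
  from (inj₁ refl)       = zero , partialSum-zero z
  from (inj₂ (k , refl)) = suc k , refl

differences⇒partialSum : ∀ {m} (z : Fin m → ℤ) (e : Fin (suc m) → ℤ) →
  (∀ k → z k ≡ e (suc k) - e (inject₁ k)) → ∀ i → partialSum z i ≡ e i - e zero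
differences⇒partialSum z e z≡Δe zero = trans (partialSum-zero z) (sym (ℤ.i≡j⇒i-j≡0 {e zero} refl))
differences⇒partialSum {suc m} z e z≡Δe (suc k) = begin
  z zero + partialSum (z ∘ suc) k
    ≡⟨ cong₂ _+_ (z≡Δe zero) (differences⇒partialSum (z ∘ suc) (e ∘ suc) (z≡Δe ∘ suc) k) ⟩
  (e (suc zero) - e zero) + (e (suc k) - e (suc zero))
    ≡⟨ telescope (e (suc k)) (e (suc zero)) (e zero) ⟩
  e (suc k) - e zero
    ∎
  where
  telescope : ∀ x y w → (y - w) + (x - y) ≡ x - w
  telescope = solve-∀

partialSum⇒differences : ∀ {m} (z : Fin m → ℤ) (e : Fin (suc m) → ℤ) c →
  (∀ i → partialSum z i ≡ c + e i) → ∀ k → z k ≡ e (suc k) - e (inject₁ k)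
partialSum⇒differences z e c P≡c+e k = begin
  z k                                                ≡⟨ [p+w]-p≡w (partialSum z (inject₁ k)) (z k) ⟨
  (partialSum z (inject₁ k) + z k) - partialSum z (inject₁ k)
    ≡⟨ cong (_- partialSum z (inject₁ k)) (partialSum-suc z k) ⟨
  partialSum z (suc k) - partialSum z (inject₁ k)    ≡⟨ cong₂ _-_ (P≡c+e (suc k)) (P≡c+e (inject₁ k)) ⟩
  (c + e (suc k)) - (c + e (inject₁ k))              ≡⟨ [c+x]-[c+y]≡x-y c (e (suc k)) (e (inject₁ k)) ⟩
  e (suc k) - e (inject₁ k)                          ∎
  where
  [p+w]-p≡w : ∀ p w → (p + w) - p ≡ w
  [p+w]-p≡w = solve-∀
  [c+x]-[c+y]≡x-y : ∀ c x y → (c + x) - (c + y) ≡ x - y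
  [c+x]-[c+y]≡x-y = solve-∀

D⇒partialSum≡shift∘π : ∀ {m} (z : Fin m → ℤ) (π : Permutation′ (suc m)) →
  (∀ k → z k ≡ D π k) → ∀ i → partialSum z i ≡ shift (+ 1 - entry π zero) (π ⟨$⟩ʳ i)
D⇒partialSum≡shift∘π z π z≡Dπ i = begin
  partialSum z i                                  ≡⟨ differences⇒partialSum z (entry π) z≡Dπ i ⟩
  (+ 1 + + toℕ (π ⟨$⟩ʳ i)) - entry π zero         ≡⟨ [1+t]-p≡[1-p]+t (entry π zero) (+ toℕ (π ⟨$⟩ʳ i)) ⟩
  (+ 1 - entry π zero) + + toℕ (π ⟨$⟩ʳ i)         ∎
  where
  [1+t]-p≡[1-p]+t : ∀ p t → (+ 1 + t) - p ≡ (+ 1 - p) + t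
  [1+t]-p≡[1-p]+t = solve-∀

partialSum≡shift∘π⇒D : ∀ {m} (z : Fin m → ℤ) (π : Permutation′ (suc m)) a →
  (∀ i → partialSum z i ≡ shift a (π ⟨$⟩ʳ i)) → ∀ k → z k ≡ D π k
partialSum≡shift∘π⇒D z π a P≡shift∘π = partialSum⇒differences z (entry π) (a - + 1) λ i →
  trans (P≡shift∘π i) ([a+t]≡[a-1]+[1+t] a (+ toℕ (π ⟨$⟩ʳ i)))
  where
  [a+t]≡[a-1]+[1+t] : ∀ a t → a + t ≡ (a - + 1) + (+ 1 + t)
  [a+t]≡[a-1]+[1+t] = solve-∀

consecutive⇔sameImage : ∀ {m} (z : Fin m → ℤ) a →
  (∀ x → (S z x → Interval a (suc m) x) × (Interval a (suc m) x → S z x))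
    ⇔ SameImage (partialSum z) (shift a)
consecutive⇔sameImage z a = mk⇔
  (λ S≐I x →
    interval⇒image-shift a x ∘ proj₁ (S≐I x) ∘ Equivalence.to (image-partialSum⇔S z x) ,
    Equivalence.from (image-partialSum⇔S z x) ∘ proj₂ (S≐I x) ∘ image-shift⇒interval a x)
  (λ sameImage x →
    image-shift⇒interval a x ∘ proj₁ (sameImage x) ∘ Equivalence.from (image-partialSum⇔S z x) ,
    Equivalence.to (image-partialSum⇔S z x) ∘ proj₂ (sameImage x) ∘ interval⇒image-shift a x)

proposition2p3 : (m : ℕ) (z : Fin m → ℤ) →
    (∃ λ (π : Permutation′ (suc m)) → ∀ k → z k ≡ D π k)
      ⇔ (ConsecutiveSet (S z) (suc m) × S z 0ℤ)
proposition2p3 m z = mk⇔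
  (λ (π , z≡Dπ) →
    let a = + 1 - entry π zero in
    (a , Equivalence.from (consecutive⇔sameImage z a)
           (permutation⇒sameImage (partialSum z) (shift a) π (D⇒partialSum≡shift∘π z π z≡Dπ))) ,
    inj₁ refl)
  (λ ((a , S≐I) , _) →
    let (π , P≡shift∘π) = sameImage⇒permutation (partialSum z) (shift a) (shift-injective a)
                            (Equivalence.to (consecutive⇔sameImage z a) S≐I)
    in π , partialSum≡shift∘π⇒D z π a P≡shift∘π)
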